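{- Let $\alpha,\beta\in[0,1]$ and $c\ge1$. Assume (A) $|I_i|>(1-\beta)\mathrm{AVG}$ for every $i\in[n]$, and (B) for every three distinct indices $i,j,k$ there exist $r\ne s\in\{i,j,k\}$ with $|I_r\cap I_s|>\alpha\,\mathrm{AVG}$. Let $S_1=\{\pi_j: |I_j\cap I_1|>\alpha\,\mathrm{AVG}\}$. If $|S_1|\ge n/c$, then $\mathrm{Obj}(\sigma_1)\le\left(3-\frac{2\alpha}{c}\right)\mathrm{OPT}$.
   Context: $\mathbb{S}_d$ is the set of rankings of $[d]$; $a\prec_\pi b$ means $a$ precedes $b$ in $\pi$; Kendall tau distance $\kappa(\pi,\sigma)=|\{(a,b): a\prec_\pi b,\ b\prec_\sigma a\}|$. Fix a nonempty set $\mathcal{F}\subseteq\mathbb{S}_d$ of rankings called fair. Let $S=\{\pi_1,\dots,\pi_n\}$ be the input list of $n$ rankings, $\mathrm{Obj}(\sigma)=\sum_{j=1}^n\kappa(\sigma,\pi_j)$, $\sigma^*\in\mathcal{F}$ a minimizer of $\mathrm{Obj}$ over $\mathcal{F}$, $\mathrm{OPT}=\mathrm{Obj}(\sigma^*)$, $\mathrm{AVG}=\mathrm{OPT}/n$, $I_i=\{(a,b): a\prec_{\pi_i}b,\ b\prec_{\sigma^*}a\}$, and $\sigma_i\in\mathcal{F}$ a closest fair ranking to $\pi_i$ (minimizing $\kappa(\pi_i,\cdot)$ over $\mathcal{F}$). The rankings are indexed so that $|I_1|\le|I_2|\le\dots\le|I_n|$.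
   Formalization: The parameters $\alpha,\beta\in[0,1]$ and $c\ge1$ range over the rationals. -}

module Defs where

open import Data.Nat as ℕ using (ℕ)
open import Data.Integer using (+_)
open import Data.Rational using (ℚ; _/_; _*_)
import Data.Rational.Properties as ℚP
open import Data.Fin as Fin using (Fin)
open import Data.Fin.Permutation using (Permutation′; _⟨$⟩ʳ_)
open import Data.List using (List; length; filter; cartesianProduct; allFin; map)
open import Data.Nat.ListAction using (sum)
open import Data.Product using (_×_; _,_)
open import Relation.Nullary using (Dec)
open import Relation.Nullary.Decidable using (_×-dec_)

-- A ranking of [d] = Fin d: a bijection sending each item to its position.
Ranking : ℕ → Set
Ranking d = Permutation′ d

_≺[_]_ : ∀ {d} → Fin d → Ranking d → Fin d → Set
a ≺[ π ] b = (π ⟨$⟩ʳ a) Fin.< (π ⟨$⟩ʳ b)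

_≺?[_]_ : ∀ {d} (a : Fin d) (π : Ranking d) (b : Fin d) → Dec (a ≺[ π ] b)
a ≺?[ π ] b = (π ⟨$⟩ʳ a) Fin.<? (π ⟨$⟩ʳ b)

pairs : (d : ℕ) → List (Fin d × Fin d)
pairs d = cartesianProduct (allFin d) (allFin d)

Inv : ∀ {d} → Ranking d → Ranking d → Fin d × Fin d → Set
Inv π σ (a , b) = (a ≺[ π ] b) × (b ≺[ σ ] a)

inv? : ∀ {d} (π σ : Ranking d) (p : Fin d × Fin d) → Dec (Inv π σ p)
inv? π σ (a , b) = (a ≺?[ π ] b) ×-dec (b ≺?[ σ ] a)

κ : ∀ {d} → Ranking d → Ranking d → ℕ
κ {d} π σ = length (filter (inv? π σ) (pairs d))

interCard : ∀ {d} → Ranking d → Ranking d → Ranking d → ℕ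
interCard {d} π π' σ = length (filter (λ p → inv? π σ p ×-dec inv? π' σ p) (pairs d))

Obj : ∀ {d n} → (Fin n → Ranking d) → Ranking d → ℕ
Obj {n = n} π σ = sum (map (λ j → κ σ (π j)) (allFin n))

ℕ→ℚ : ℕ → ℚ
ℕ→ℚ k = (+ k) / 1

-- |S_1| = number of indices j with |I_j ∩ I_1| > α·AVG
-- (I_j computed against the fair optimum σ*, index 1 = Fin.zero)
S₁card : ∀ {d m} → (Fin (ℕ.suc m) → Ranking d) → Ranking d → (αAVG : ℚ) → ℕ
S₁card {m = m} π σ* αAVG =
  length (filter (λ j → αAVG ℚP.<? ℕ→ℚ (interCard (π j) (π Fin.zero) σ*)) (allFin (ℕ.suc m)))

-- Summing over unordered pairs {a,b} the inequality between disagreement indicators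
--   [σ₁ ≠ πⱼ] + 2[πⱼ = π₁ ≠ σ*] ≤ [π₁ ≠ σ₁] + [π₁ ≠ σ*] + [πⱼ ≠ σ*]
-- (the triangle inequality, sharpened on I₁ ∩ Iⱼ) gives
--   κ(σ₁,πⱼ) + 2|Iⱼ ∩ I₁| ≤ κ(π₁,σ₁) + κ(π₁,σ*) + κ(πⱼ,σ*) ≤ 3κ(πⱼ,σ*),
-- since σ* is fair, σ₁ is a closest fair ranking to π₁, and |I₁| is the least |Iᵢ|.
-- Summing over j, Obj(σ₁) + 2Σⱼ|Iⱼ ∩ I₁| ≤ 3 OPT, and the sum is at least
-- |S₁| · α AVG ≥ (n/c) · α AVG = α OPT / c.
module Submission where

open import Defs
open import Data.Bool using (Bool; true; false; not; _∧_)
open import Data.Bool.Properties using (∧-comm)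
open import Data.Empty using (⊥-elim)
open import Data.Fin as Fin using (Fin)
import Data.Fin.Properties as Finₚ
open import Data.Fin.Permutation using (_⟨$⟩ʳ_; _⟨$⟩ˡ_; inverseˡ)
open import Data.Integer as ℤ using (+_)
import Data.Integer.Properties as ℤₚ
open import Data.List using (List; []; _∷_; _++_; length; filter; cartesianProduct; allFin; map)
open import Data.List.Properties using (map-++; filter-accept; filter-reject)
open import Data.Nat as ℕ using (ℕ; suc; z≤n)
open import Data.Nat.Coprimality as Coprimality using (1-coprimeTo)
open import Data.Nat.ListAction using (sum)
open import Data.Nat.ListAction.Properties using (sum-++)
import Data.Nat.Properties as ℕₚ
open import Algebra.Properties.CommutativeSemigroup ℕₚ.+-commutativeSemigroup
  using () renaming (interchange to +-interchange)
open import Data.Product using (_×_; _,_; swap)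
open import Data.Rational as ℚ using (ℚ; mkℚ; _/_; _÷_; _+_; _*_; _-_; _≤_; _<_; _<?_; NonZero; 0ℚ; 1ℚ)
import Data.Rational.Properties as ℚₚ
import Data.Rational.Unnormalised as ℚᵘ
import Data.Rational.Unnormalised.Properties as ℚᵘₚ
open import Data.Rational.Solver using (module +-*-Solver)
open import Data.Sum using (_⊎_)
open import Relation.Binary using (tri<; tri≈; tri>)
open import Relation.Binary.PropositionalEquality
open import Relation.Nullary using (Dec; does; yes; no)
open import Relation.Nullary.Decidable using (dec-true; dec-false)

𝟙 : Bool → ℕ
𝟙 true  = 1
𝟙 false = 0

module _ {A : Set} where

  ∑ : List A → (A → ℕ) → ℕ
  ∑ xs f = sum (map f xs)

  syntax ∑ xs (λ x → e) = ∑[ x ∈ xs ] e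

  length-filter≡∑𝟙 : ∀ {P : A → Set} (P? : ∀ x → Dec (P x)) xs →
                     length (filter P? xs) ≡ ∑[ x ∈ xs ] 𝟙 (does (P? x))
  length-filter≡∑𝟙 P? []       = refl
  length-filter≡∑𝟙 P? (x ∷ xs) with does (P? x)
  ... | true  = cong suc (length-filter≡∑𝟙 P? xs)
  ... | false = length-filter≡∑𝟙 P? xs

  ∑-cong : ∀ {f g : A → ℕ} → (∀ x → f x ≡ g x) → ∀ xs → ∑ xs f ≡ ∑ xs g
  ∑-cong f≡g []       = refl
  ∑-cong f≡g (x ∷ xs) = cong₂ ℕ._+_ (f≡g x) (∑-cong f≡g xs)

  ∑-mono-≤ : ∀ {f g : A → ℕ} → (∀ x → f x ℕ.≤ g x) → ∀ xs → ∑ xs f ℕ.≤ ∑ xs g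
  ∑-mono-≤ f≤g []       = z≤n
  ∑-mono-≤ f≤g (x ∷ xs) = ℕₚ.+-mono-≤ (f≤g x) (∑-mono-≤ f≤g xs)

  ∑-zero : ∀ xs → ∑[ x ∈ xs ] 0 ≡ 0
  ∑-zero []       = refl
  ∑-zero (x ∷ xs) = ∑-zero xs

  ∑-distrib-+ : ∀ (f g : A → ℕ) xs → ∑[ x ∈ xs ] (f x ℕ.+ g x) ≡ ∑ xs f ℕ.+ ∑ xs g
  ∑-distrib-+ f g []       = refl
  ∑-distrib-+ f g (x ∷ xs) = begin
    f x ℕ.+ g x ℕ.+ ∑[ y ∈ xs ] (f y ℕ.+ g y) ≡⟨ cong (f x ℕ.+ g x ℕ.+_) (∑-distrib-+ f g xs) ⟩
    f x ℕ.+ g x ℕ.+ (∑ xs f ℕ.+ ∑ xs g)       ≡⟨ +-interchange (f x) (g x) (∑ xs f) (∑ xs g) ⟩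
    f x ℕ.+ ∑ xs f ℕ.+ (g x ℕ.+ ∑ xs g)       ∎
    where open ≡-Reasoning

  ∑-distribˡ-* : ∀ k (f : A → ℕ) xs → ∑[ x ∈ xs ] (k ℕ.* f x) ≡ k ℕ.* ∑ xs f
  ∑-distribˡ-* k f []       = sym (ℕₚ.*-zeroʳ k)
  ∑-distribˡ-* k f (x ∷ xs) = trans (cong (k ℕ.* f x ℕ.+_) (∑-distribˡ-* k f xs))
                                    (sym (ℕₚ.*-distribˡ-+ k (f x) (∑ xs f)))

∑-++ : ∀ {A : Set} (f : A → ℕ) xs ys → ∑ (xs ++ ys) f ≡ ∑ xs f ℕ.+ ∑ ys f
∑-++ f xs ys = trans (cong sum (map-++ f xs ys)) (sum-++ (map f xs) (map f ys))

∑-map : ∀ {A B : Set} (f : B → ℕ) (g : A → B) xs → ∑ (map g xs) f ≡ ∑[ x ∈ xs ] f (g x)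
∑-map f g []       = refl
∑-map f g (x ∷ xs) = cong (f (g x) ℕ.+_) (∑-map f g xs)

∑-cartesianProduct : ∀ {A B : Set} (f : A × B → ℕ) xs ys →
                     ∑ (cartesianProduct xs ys) f ≡ ∑[ x ∈ xs ] ∑[ y ∈ ys ] f (x , y)
∑-cartesianProduct f []       ys = refl
∑-cartesianProduct f (x ∷ xs) ys =
  trans (∑-++ f (map (x ,_) ys) (cartesianProduct xs ys))
        (cong₂ ℕ._+_ (∑-map f (x ,_) ys) (∑-cartesianProduct f xs ys))

∑-comm : ∀ {A B : Set} (f : A → B → ℕ) xs ys →
         ∑[ x ∈ xs ] ∑[ y ∈ ys ] f x y ≡ ∑[ y ∈ ys ] ∑[ x ∈ xs ] f x y
∑-comm f []       ys = sym (∑-zero ys)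
∑-comm f (x ∷ xs) ys = trans (cong (∑ ys (f x) ℕ.+_) (∑-comm f xs ys))
                             (sym (∑-distrib-+ (f x) (λ y → ∑[ x ∈ xs ] f x y) ys))

∑-swap : ∀ {A : Set} (f : A × A → ℕ) xs →
         ∑[ p ∈ cartesianProduct xs xs ] f (swap p) ≡ ∑ (cartesianProduct xs xs) f
∑-swap f xs = begin
  ∑[ p ∈ cartesianProduct xs xs ] f (swap p) ≡⟨ ∑-cartesianProduct (λ p → f (swap p)) xs xs ⟩
  ∑[ x ∈ xs ] ∑[ y ∈ xs ] f (y , x)          ≡⟨ ∑-comm (λ x y → f (y , x)) xs xs ⟩
  ∑[ y ∈ xs ] ∑[ x ∈ xs ] f (y , x)          ≡⟨ ∑-cartesianProduct f xs xs ⟨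
  ∑ (cartesianProduct xs xs) f               ∎
  where open ≡-Reasoning

-- symmetrised-bound on the pair (a , b), in terms of the order bits t = [a ≺_τ b],
-- t′ = [b ≺_τ a], and likewise j, j′ for π′, u, u′ for π and s, s′ for σ.
PairBound : (t t′ j j′ u u′ s s′ : Bool) → Set
PairBound t t′ j j′ u u′ s s′ =
  𝟙 (t ∧ j′) ℕ.+ 𝟙 (t′ ∧ j) ℕ.+ 2 ℕ.* (𝟙 ((j ∧ s′) ∧ (u ∧ s′)) ℕ.+ 𝟙 ((j′ ∧ s) ∧ (u′ ∧ s)))
  ℕ.≤ 𝟙 (u ∧ t′) ℕ.+ 𝟙 (u′ ∧ t) ℕ.+ (𝟙 (u ∧ s′) ℕ.+ 𝟙 (u′ ∧ s)) ℕ.+ (𝟙 (j ∧ s′) ℕ.+ 𝟙 (j′ ∧ s))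

-- With opposite bits this reads [t ≠ j] + 2[j = u ≠ s] ≤ [u ≠ t] + [u ≠ s] + [j ≠ s].
pairBound-not : ∀ t j u s → PairBound t (not t) j (not j) u (not u) s (not s)
pairBound-not true  true  true  true  = ℕₚ.≤ᵇ⇒≤ _ _ _
pairBound-not true  true  true  false = ℕₚ.≤ᵇ⇒≤ _ _ _
pairBound-not true  true  false true  = ℕₚ.≤ᵇ⇒≤ _ _ _
pairBound-not true  true  false false = ℕₚ.≤ᵇ⇒≤ _ _ _
pairBound-not true  false true  true  = ℕₚ.≤ᵇ⇒≤ _ _ _
pairBound-not true  false true  false = ℕₚ.≤ᵇ⇒≤ _ _ _
pairBound-not true  false false true  = ℕₚ.≤ᵇ⇒≤ _ _ _
pairBound-not true  false false false = ℕₚ.≤ᵇ⇒≤ _ _ _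
pairBound-not false true  true  true  = ℕₚ.≤ᵇ⇒≤ _ _ _
pairBound-not false true  true  false = ℕₚ.≤ᵇ⇒≤ _ _ _
pairBound-not false true  false true  = ℕₚ.≤ᵇ⇒≤ _ _ _
pairBound-not false true  false false = ℕₚ.≤ᵇ⇒≤ _ _ _
pairBound-not false false true  true  = ℕₚ.≤ᵇ⇒≤ _ _ _
pairBound-not false false true  false = ℕₚ.≤ᵇ⇒≤ _ _ _
pairBound-not false false false true  = ℕₚ.≤ᵇ⇒≤ _ _ _
pairBound-not false false false false = ℕₚ.≤ᵇ⇒≤ _ _ _

pairBound-opposite : ∀ {t t′ j j′ u u′ s s′} →
  t′ ≡ not t → j′ ≡ not j → u′ ≡ not u → s′ ≡ not s → PairBound t t′ j j′ u u′ s s′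
pairBound-opposite {t} {j = j} {u = u} {s = s} refl refl refl refl = pairBound-not t j u s

pairBound-false : ∀ {t j u s} → t ≡ false → j ≡ false → u ≡ false → s ≡ false → PairBound t t j j u u s s
pairBound-false refl refl refl refl = z≤n

module _ {d : ℕ} where

  _≺ᵇ[_]_ : Fin d → Ranking d → Fin d → Bool
  a ≺ᵇ[ π ] b = does (a ≺?[ π ] b)

  ≺ᵇ-irrefl : ∀ π a → a ≺ᵇ[ π ] a ≡ false
  ≺ᵇ-irrefl π a = dec-false (a ≺?[ π ] a) (Finₚ.<-irrefl refl)

  ≺ᵇ-flip : ∀ π {a b} → a ≢ b → b ≺ᵇ[ π ] a ≡ not (a ≺ᵇ[ π ] b)
  ≺ᵇ-flip π {a} {b} a≢b with Finₚ.<-cmp (π ⟨$⟩ʳ a) (π ⟨$⟩ʳ b)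
  ... | tri< a<b _ _ rewrite dec-true (a ≺?[ π ] b) a<b = dec-false (b ≺?[ π ] a) (Finₚ.<-asym a<b)
  ... | tri> _ _ b<a rewrite dec-true (b ≺?[ π ] a) b<a = cong not (sym (dec-false (a ≺?[ π ] b) (Finₚ.<-asym b<a)))
  ... | tri≈ _ a≈b _ = ⊥-elim (a≢b (trans (sym (inverseˡ π)) (trans (cong (π ⟨$⟩ˡ_) a≈b) (inverseˡ π))))

  inversion : Ranking d → Ranking d → Fin d × Fin d → ℕ
  inversion π σ p = 𝟙 (does (inv? π σ p))

  commonInversion : Ranking d → Ranking d → Ranking d → Fin d × Fin d → ℕ
  commonInversion π π′ σ p = 𝟙 (does (inv? π σ p) ∧ does (inv? π′ σ p))

  κ≡∑inversion : ∀ π σ → κ π σ ≡ ∑ (pairs d) (inversion π σ)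
  κ≡∑inversion π σ = length-filter≡∑𝟙 (inv? π σ) (pairs d)

  interCard≡∑commonInversion : ∀ π π′ σ → interCard π π′ σ ≡ ∑ (pairs d) (commonInversion π π′ σ)
  interCard≡∑commonInversion π π′ σ = length-filter≡∑𝟙 _ (pairs d)

  κ-sym : ∀ π σ → κ π σ ≡ κ σ π
  κ-sym π σ = begin
    κ π σ                                        ≡⟨ κ≡∑inversion π σ ⟩
    ∑ (pairs d) (inversion π σ)                  ≡⟨ ∑-swap (inversion π σ) (allFin d) ⟨
    ∑[ p ∈ pairs d ] inversion π σ (swap p)      ≡⟨ ∑-cong (λ { (a , b) → cong 𝟙 (∧-comm (b ≺ᵇ[ π ] a) (a ≺ᵇ[ σ ] b)) }) (pairs d) ⟩
    ∑ (pairs d) (inversion σ π)                  ≡⟨ κ≡∑inversion σ π ⟨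
    κ σ π                                        ∎
    where open ≡-Reasoning

  symmetrise : (Fin d × Fin d → ℕ) → Fin d × Fin d → ℕ
  symmetrise f p = f p ℕ.+ f (swap p)

  ∑-symmetrise : ∀ f → ∑ (pairs d) (symmetrise f) ≡ 2 ℕ.* ∑ (pairs d) f
  ∑-symmetrise f = begin
    ∑ (pairs d) (symmetrise f)                         ≡⟨ ∑-distrib-+ f (λ p → f (swap p)) (pairs d) ⟩
    ∑ (pairs d) f ℕ.+ ∑[ p ∈ pairs d ] f (swap p)      ≡⟨ cong (∑ (pairs d) f ℕ.+_) (∑-swap f (allFin d)) ⟩
    ∑ (pairs d) f ℕ.+ ∑ (pairs d) f                    ≡⟨ cong (∑ (pairs d) f ℕ.+_) (ℕₚ.+-identityʳ _) ⟨
    2 ℕ.* ∑ (pairs d) f                                ∎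
    where open ≡-Reasoning

  -- Symmetrising is essential: the bound fails for some ordered pairs on their own.
  symmetrised-bound : ∀ (τ π′ π σ : Ranking d) p →
    symmetrise (inversion τ π′) p ℕ.+ 2 ℕ.* symmetrise (commonInversion π′ π σ) p
    ℕ.≤ symmetrise (inversion π τ) p ℕ.+ symmetrise (inversion π σ) p ℕ.+ symmetrise (inversion π′ σ) p
  symmetrised-bound τ π′ π σ (a , b) with a Fin.≟ b
  ... | yes refl = pairBound-false (≺ᵇ-irrefl τ a) (≺ᵇ-irrefl π′ a) (≺ᵇ-irrefl π a) (≺ᵇ-irrefl σ a)
  ... | no a≢b   = pairBound-opposite (≺ᵇ-flip τ a≢b) (≺ᵇ-flip π′ a≢b) (≺ᵇ-flip π a≢b) (≺ᵇ-flip σ a≢b)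

  2*κ≡∑symmetrise : ∀ π σ → 2 ℕ.* κ π σ ≡ ∑ (pairs d) (symmetrise (inversion π σ))
  2*κ≡∑symmetrise π σ = trans (cong (2 ℕ.*_) (κ≡∑inversion π σ)) (sym (∑-symmetrise (inversion π σ)))

  2*interCard≡∑symmetrise : ∀ π π′ σ →
    2 ℕ.* interCard π π′ σ ≡ ∑ (pairs d) (symmetrise (commonInversion π π′ σ))
  2*interCard≡∑symmetrise π π′ σ =
    trans (cong (2 ℕ.*_) (interCard≡∑commonInversion π π′ σ)) (sym (∑-symmetrise (commonInversion π π′ σ)))

  κ+2*interCard≤κ+κ+κ : ∀ (τ π′ π σ : Ranking d) →
    κ τ π′ ℕ.+ 2 ℕ.* interCard π′ π σ ℕ.≤ κ π τ ℕ.+ κ π σ ℕ.+ κ π′ σ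
  κ+2*interCard≤κ+κ+κ τ π′ π σ = ℕₚ.*-cancelˡ-≤ 2 (begin
    2 ℕ.* (κ τ π′ ℕ.+ 2 ℕ.* interCard π′ π σ)
      ≡⟨ ℕₚ.*-distribˡ-+ 2 (κ τ π′) _ ⟩
    2 ℕ.* κ τ π′ ℕ.+ 2 ℕ.* (2 ℕ.* interCard π′ π σ)
      ≡⟨ cong₂ (λ x y → x ℕ.+ 2 ℕ.* y) (2*κ≡∑symmetrise τ π′) (2*interCard≡∑symmetrise π′ π σ) ⟩
    Σ (symmetrise (inversion τ π′)) ℕ.+ 2 ℕ.* Σ (symmetrise (commonInversion π′ π σ))
      ≡⟨ cong (Σ (symmetrise (inversion τ π′)) ℕ.+_) (∑-distribˡ-* 2 _ (pairs d)) ⟨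
    Σ (symmetrise (inversion τ π′)) ℕ.+ Σ (λ p → 2 ℕ.* symmetrise (commonInversion π′ π σ) p)
      ≡⟨ ∑-distrib-+ _ _ (pairs d) ⟨
    Σ (λ p → symmetrise (inversion τ π′) p ℕ.+ 2 ℕ.* symmetrise (commonInversion π′ π σ) p)
      ≤⟨ ∑-mono-≤ (symmetrised-bound τ π′ π σ) (pairs d) ⟩
    Σ (λ p → symmetrise (inversion π τ) p ℕ.+ symmetrise (inversion π σ) p ℕ.+ symmetrise (inversion π′ σ) p)
      ≡⟨ ∑-distrib-+ _ _ (pairs d) ⟩
    Σ (λ p → symmetrise (inversion π τ) p ℕ.+ symmetrise (inversion π σ) p) ℕ.+ Σ (symmetrise (inversion π′ σ))
      ≡⟨ cong (ℕ._+ Σ (symmetrise (inversion π′ σ))) (∑-distrib-+ _ _ (pairs d)) ⟩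
    Σ (symmetrise (inversion π τ)) ℕ.+ Σ (symmetrise (inversion π σ)) ℕ.+ Σ (symmetrise (inversion π′ σ))
      ≡⟨ cong₂ ℕ._+_ (cong₂ ℕ._+_ (2*κ≡∑symmetrise π τ) (2*κ≡∑symmetrise π σ)) (2*κ≡∑symmetrise π′ σ) ⟨
    2 ℕ.* κ π τ ℕ.+ 2 ℕ.* κ π σ ℕ.+ 2 ℕ.* κ π′ σ
      ≡⟨ cong (ℕ._+ 2 ℕ.* κ π′ σ) (ℕₚ.*-distribˡ-+ 2 (κ π τ) (κ π σ)) ⟨
    2 ℕ.* (κ π τ ℕ.+ κ π σ) ℕ.+ 2 ℕ.* κ π′ σ
      ≡⟨ ℕₚ.*-distribˡ-+ 2 (κ π τ ℕ.+ κ π σ) (κ π′ σ) ⟨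
    2 ℕ.* (κ π τ ℕ.+ κ π σ ℕ.+ κ π′ σ) ∎)
    where
    open ℕₚ.≤-Reasoning
    Σ : (Fin d × Fin d → ℕ) → ℕ
    Σ = ∑ (pairs d)

  κ+2*interCard≤3*κ : ∀ (τ π′ π σ : Ranking d) → κ π τ ℕ.≤ κ π σ → κ π σ ℕ.≤ κ π′ σ →
    κ τ π′ ℕ.+ 2 ℕ.* interCard π′ π σ ℕ.≤ 3 ℕ.* κ σ π′
  κ+2*interCard≤3*κ τ π′ π σ πτ≤πσ πσ≤π′σ = begin
    κ τ π′ ℕ.+ 2 ℕ.* interCard π′ π σ ≤⟨ κ+2*interCard≤κ+κ+κ τ π′ π σ ⟩
    κ π τ ℕ.+ κ π σ ℕ.+ κ π′ σ        ≤⟨ ℕₚ.+-monoˡ-≤ (κ π′ σ) (ℕₚ.+-mono-≤ (ℕₚ.≤-trans πτ≤πσ πσ≤π′σ) πσ≤π′σ) ⟩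
    κ π′ σ ℕ.+ κ π′ σ ℕ.+ κ π′ σ      ≡⟨ cong (λ x → x ℕ.+ x ℕ.+ x) (κ-sym π′ σ) ⟩
    κ σ π′ ℕ.+ κ σ π′ ℕ.+ κ σ π′      ≡⟨ ℕₚ.+-assoc (κ σ π′) (κ σ π′) _ ⟩
    κ σ π′ ℕ.+ (κ σ π′ ℕ.+ κ σ π′)    ≡⟨ cong (λ x → κ σ π′ ℕ.+ (κ σ π′ ℕ.+ x)) (ℕₚ.+-identityʳ (κ σ π′)) ⟨
    3 ℕ.* κ σ π′                      ∎
    where open ℕₚ.≤-Reasoning

  Obj+2*∑interCard≤3*Obj : ∀ {n} (π : Fin n → Ranking d) (i : Fin n) (τ σ : Ranking d) →
    κ (π i) τ ℕ.≤ κ (π i) σ → (∀ j → κ (π i) σ ℕ.≤ κ (π j) σ) →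
    Obj π τ ℕ.+ 2 ℕ.* (∑[ j ∈ allFin n ] interCard (π j) (π i) σ) ℕ.≤ 3 ℕ.* Obj π σ
  Obj+2*∑interCard≤3*Obj {n} π i τ σ iτ≤iσ iσ≤jσ = begin
    Obj π τ ℕ.+ 2 ℕ.* ∑ (allFin n) common
      ≡⟨ cong (Obj π τ ℕ.+_) (∑-distribˡ-* 2 common (allFin n)) ⟨
    Obj π τ ℕ.+ (∑[ j ∈ allFin n ] (2 ℕ.* common j))
      ≡⟨ ∑-distrib-+ (λ j → κ τ (π j)) (λ j → 2 ℕ.* common j) (allFin n) ⟨
    (∑[ j ∈ allFin n ] (κ τ (π j) ℕ.+ 2 ℕ.* common j))
      ≤⟨ ∑-mono-≤ (λ j → κ+2*interCard≤3*κ τ (π j) (π i) σ iτ≤iσ (iσ≤jσ j)) (allFin n) ⟩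
    (∑[ j ∈ allFin n ] (3 ℕ.* κ σ (π j)))
      ≡⟨ ∑-distribˡ-* 3 (λ j → κ σ (π j)) (allFin n) ⟩
    3 ℕ.* Obj π σ ∎
    where
    open ℕₚ.≤-Reasoning
    common : Fin n → ℕ
    common j = interCard (π j) (π i) σ

ℕ→ℚ≡mkℚ : ∀ k → ℕ→ℚ k ≡ mkℚ (+ k) 0 (Coprimality.sym (1-coprimeTo k))
ℕ→ℚ≡mkℚ k = ℚₚ.normalize-coprime (Coprimality.sym (1-coprimeTo k))

ℕ→ℚ-homo-+ : ∀ a b → ℕ→ℚ (a ℕ.+ b) ≡ ℕ→ℚ a + ℕ→ℚ b
ℕ→ℚ-homo-+ a b rewrite ℕ→ℚ≡mkℚ a | ℕ→ℚ≡mkℚ b =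
  ℚₚ./-cong {p₁ = + (a ℕ.+ b)} {q₁ = 1} {q₂ = 1}
    (cong₂ ℤ._+_ (sym (ℤₚ.*-identityʳ (+ a))) (sym (ℤₚ.*-identityʳ (+ b)))) refl

ℕ→ℚ-homo-* : ∀ a b → ℕ→ℚ (a ℕ.* b) ≡ ℕ→ℚ a * ℕ→ℚ b
ℕ→ℚ-homo-* a b rewrite ℕ→ℚ≡mkℚ a | ℕ→ℚ≡mkℚ b =
  ℚₚ./-cong {p₁ = + (a ℕ.* b)} {q₁ = 1} {q₂ = 1} (ℤₚ.pos-* a b) refl

ℕ→ℚ-mono-≤ : ∀ {a b} → a ℕ.≤ b → ℕ→ℚ a ≤ ℕ→ℚ b
ℕ→ℚ-mono-≤ {a} {b} a≤b rewrite ℕ→ℚ≡mkℚ a | ℕ→ℚ≡mkℚ b =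
  ℚ.*≤* (subst₂ ℤ._≤_ (ℤₚ.pos-* a 1) (ℤₚ.pos-* b 1) (ℤ.+≤+ (ℕₚ.*-monoˡ-≤ 1 a≤b)))

ℕ→ℚ-*-/ : ∀ m k → ℕ→ℚ (suc m) * ((+ k) / suc m) ≡ ℕ→ℚ k
ℕ→ℚ-*-/ m k = ℚₚ.toℚᵘ-injective (ℚᵘₚ.≃-trans (ℚₚ.toℚᵘ-homo-* (ℕ→ℚ (suc m)) ((+ k) / suc m))
  (ℚᵘₚ.≃-trans (ℚᵘₚ.*-cong (ℚₚ.toℚᵘ-fromℚᵘ (ℚᵘ.mkℚᵘ (+ suc m) 0)) (ℚₚ.toℚᵘ-fromℚᵘ (ℚᵘ.mkℚᵘ (+ k) m)))
  (ℚᵘₚ.≃-trans unnormalised (ℚᵘₚ.≃-sym (ℚₚ.toℚᵘ-fromℚᵘ (ℚᵘ.mkℚᵘ (+ k) 0))))))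
  where
  unnormalised : ℚᵘ.mkℚᵘ (+ suc m) 0 ℚᵘ.* ℚᵘ.mkℚᵘ (+ k) m ℚᵘ.≃ ℚᵘ.mkℚᵘ (+ k) 0
  unnormalised = ℚᵘ.*≡* (begin
    + suc m ℤ.* + k ℤ.* + 1    ≡⟨ ℤₚ.*-identityʳ _ ⟩
    + suc m ℤ.* + k            ≡⟨ ℤₚ.*-comm (+ suc m) (+ k) ⟩
    + k ℤ.* + suc m            ≡⟨ cong (λ x → + k ℤ.* + suc x) (ℕₚ.+-identityʳ m) ⟨
    + k ℤ.* + suc (m ℕ.+ 0)    ∎)
    where open ≡-Reasoning

count>-*≤∑ : ∀ {A : Set} (f : A → ℕ) (r : ℚ) xs →
  ℕ→ℚ (length (filter (λ x → r <? ℕ→ℚ (f x)) xs)) * r ≤ ℕ→ℚ (∑ xs f)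
count>-*≤∑ f r []       = ℚₚ.≤-reflexive (ℚₚ.*-zeroˡ r)
count>-*≤∑ f r (x ∷ xs) = step (r <? ℕ→ℚ (f x))
  where
  open ℚₚ.≤-Reasoning
  r<f? = λ y → r <? ℕ→ℚ (f y)
  ℓ = length (filter r<f? xs)
  step : Dec (r < ℕ→ℚ (f x)) → ℕ→ℚ (length (filter r<f? (x ∷ xs))) * r ≤ ℕ→ℚ (f x ℕ.+ ∑ xs f)
  step (yes r<fx) = begin
    ℕ→ℚ (length (filter r<f? (x ∷ xs))) * r ≡⟨ cong (λ l → ℕ→ℚ (length l) * r) (filter-accept r<f? r<fx) ⟩
    ℕ→ℚ (suc ℓ) * r                         ≡⟨ cong (_* r) (ℕ→ℚ-homo-+ 1 ℓ) ⟩
    (ℕ→ℚ 1 + ℕ→ℚ ℓ) * r                     ≡⟨ ℚₚ.*-distribʳ-+ r (ℕ→ℚ 1) (ℕ→ℚ ℓ) ⟩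
    ℕ→ℚ 1 * r + ℕ→ℚ ℓ * r                   ≡⟨ cong (_+ ℕ→ℚ ℓ * r) (ℚₚ.*-identityˡ r) ⟩
    r + ℕ→ℚ ℓ * r                           ≤⟨ ℚₚ.+-mono-≤ (ℚₚ.<⇒≤ r<fx) (count>-*≤∑ f r xs) ⟩
    ℕ→ℚ (f x) + ℕ→ℚ (∑ xs f)                ≡⟨ ℕ→ℚ-homo-+ (f x) (∑ xs f) ⟨
    ℕ→ℚ (f x ℕ.+ ∑ xs f)                    ∎
  step (no r≮fx) = begin
    ℕ→ℚ (length (filter r<f? (x ∷ xs))) * r ≡⟨ cong (λ l → ℕ→ℚ (length l) * r) (filter-reject r<f? r≮fx) ⟩
    ℕ→ℚ ℓ * r                               ≤⟨ count>-*≤∑ f r xs ⟩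
    ℕ→ℚ (∑ xs f)                            ≤⟨ ℕ→ℚ-mono-≤ (ℕₚ.m≤n+m (∑ xs f) (f x)) ⟩
    ℕ→ℚ (f x ℕ.+ ∑ xs f)                    ∎

p+q≤r⇒p≤r-q : ∀ {p q r : ℚ} → p + q ≤ r → p ≤ r - q
p+q≤r⇒p≤r-q {p} {q} {r} p+q≤r = begin
  p          ≡⟨ solve 2 (λ p q → p := p :+ q :- q) refl p q ⟩
  p + q - q  ≤⟨ ℚₚ.+-monoˡ-≤ (ℚ.- q) p+q≤r ⟩
  r - q      ∎
  where
  open ℚₚ.≤-Reasoning
  open +-*-Solver

lemma4 : (d m : ℕ) (F : Ranking d → Set) (π : Fin (ℕ.suc m) → Ranking d)
         (σ* σ₁ : Ranking d)
         → F σ* → (∀ σ → F σ → Obj π σ* ℕ.≤ Obj π σ)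
         → F σ₁ → (∀ σ → F σ → κ (π Fin.zero) σ₁ ℕ.≤ κ (π Fin.zero) σ)
         → (∀ i j → i Fin.≤ j → κ (π i) σ* ℕ.≤ κ (π j) σ*)
         → (α β c : ℚ) → .{{_ : NonZero c}}
         → 0ℚ ≤ α → α ≤ 1ℚ → 0ℚ ≤ β → β ≤ 1ℚ → 1ℚ ≤ c
         → (∀ i → (1ℚ - β) * ((+ Obj π σ*) / ℕ.suc m) < ℕ→ℚ (κ (π i) σ*))
         → (∀ i j k → i ≢ j → i ≢ k → j ≢ k
              → (α * ((+ Obj π σ*) / ℕ.suc m) < ℕ→ℚ (interCard (π i) (π j) σ*))
                ⊎ (α * ((+ Obj π σ*) / ℕ.suc m) < ℕ→ℚ (interCard (π i) (π k) σ*))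
                ⊎ (α * ((+ Obj π σ*) / ℕ.suc m) < ℕ→ℚ (interCard (π j) (π k) σ*)))
         → ℕ→ℚ (ℕ.suc m) ÷ c ≤ ℕ→ℚ (S₁card π σ* (α * ((+ Obj π σ*) / ℕ.suc m)))
         → ℕ→ℚ (Obj π σ₁) ≤ (ℕ→ℚ 3 - (ℕ→ℚ 2 * α) ÷ c) * ℕ→ℚ (Obj π σ*)
lemma4 d m F π σ* σ₁ fair-σ* _ _ σ₁-closest sorted α _ c 0≤α _ _ _ _ _ _ n÷c≤|S₁| = begin
  T                             ≤⟨ p+q≤r⇒p≤r-q objective-bound ⟩
  three * O - two * X           ≤⟨ ℚₚ.+-monoʳ-≤ (three * O) (ℚₚ.neg-antimono-≤ (ℚₚ.*-monoˡ-≤-nonNeg two S₁-bound)) ⟩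
  three * O - two * (n ÷ c * r) ≡⟨ cong (λ o → three * o - two * (n ÷ c * r)) (ℕ→ℚ-*-/ m OPT) ⟨
  three * (n * AVG) - two * (n * ℚ.1/ c * (α * AVG))
    ≡⟨ solve 6 (λ t w n a α c⁻¹ → t :* (n :* a) :- w :* ((n :* c⁻¹) :* (α :* a)) := (t :- (w :* α) :* c⁻¹) :* (n :* a))
               refl three two n AVG α (ℚ.1/ c) ⟩
  (three - two * α ÷ c) * (n * AVG) ≡⟨ cong ((three - two * α ÷ c) *_) (ℕ→ℚ-*-/ m OPT) ⟩
  (three - two * α ÷ c) * O     ∎
  where
  open ℚₚ.≤-Reasoning
  open +-*-Solver
  OPT : ℕ
  OPT = Obj π σ*
  common : Fin (suc m) → ℕ
  common j = interCard (π j) (π Fin.zero) σ*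
  Σcommon : ℕ
  Σcommon = ∑ (allFin (suc m)) common
  AVG r n O T X two three : ℚ
  AVG = (+ OPT) / suc m
  r = α * AVG
  n = ℕ→ℚ (suc m)
  O = ℕ→ℚ OPT
  T = ℕ→ℚ (Obj π σ₁)
  X = ℕ→ℚ Σcommon
  two = ℕ→ℚ 2
  three = ℕ→ℚ 3

  objective-bound : T + two * X ≤ three * O
  objective-bound = begin
    T + two * X                  ≡⟨ cong (λ x → T + x) (ℕ→ℚ-homo-* 2 Σcommon) ⟨
    T + ℕ→ℚ (2 ℕ.* Σcommon)      ≡⟨ ℕ→ℚ-homo-+ (Obj π σ₁) (2 ℕ.* Σcommon) ⟨
    ℕ→ℚ (Obj π σ₁ ℕ.+ 2 ℕ.* Σcommon)
      ≤⟨ ℕ→ℚ-mono-≤ (Obj+2*∑interCard≤3*Obj π Fin.zero σ₁ σ* (σ₁-closest σ* fair-σ*) (λ j → sorted Fin.zero j z≤n)) ⟩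
    ℕ→ℚ (3 ℕ.* OPT)              ≡⟨ ℕ→ℚ-homo-* 3 OPT ⟩
    three * O                    ∎

  0≤r : 0ℚ ≤ r
  0≤r = ℚₚ.nonNegative⁻¹ r {{ℚₚ.nonNeg*nonNeg⇒nonNeg α {{ℚ.nonNegative 0≤α}} AVG {{ℚₚ.normalize-nonNeg OPT (suc m)}}}}

  S₁-bound : n ÷ c * r ≤ X
  S₁-bound = ℚₚ.≤-trans (ℚₚ.*-monoʳ-≤-nonNeg r {{ℚ.nonNegative 0≤r}} n÷c≤|S₁|) (count>-*≤∑ common r (allFin (suc m)))
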